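{- Let $k$ be a positive integer, $g(k)=(k+1)(\lfloor k/2\rfloor+1)-1$, $D$ a digraph, $T\subseteq V(D)$ a $(g(k)-1,g(k)-1)$-linked set with $|T|=2g(k)-1$, $\mathcal B_T$ the $T$-bramble, and $P$ a directed path in $D$ whose vertex set is a hitting set of $\mathcal B_T$. Let $\mathcal S_i$ be an $(i)$-split of $P$ with $i\in[k]$, with distinguished vertices $a_1,\dots,a_i$. Then $A=\{a_1,\dots,a_i\}$ is well-linked in $D$.
   Context: A $(T,r)$-balanced separator is a set $Z\subseteq V(D)$ such that every strong component of $D\setminus Z$ contains at most $r$ vertices of $T$; $T$ is $(k',r)$-linked if every $(T,r)$-balanced separator has size at least $k'+1$. Here the $T$-bramble is $\mathcal B_T=\{B : B\text{ an induced strongly connected subgraph of }D,\ |V(B)\cap T|\ge g(k)\}$. A bramble is a family of strongly connected subgraphs any two of which share a vertex or have edges between them in both directions; its order is the minimum size of a vertex set meeting every member (a hitting set). For $X\subseteq V(D)$, $\overline{\mathcal B_T}(X)=\{B\in\mathcal B_T: V(B)\cap X=\emptyset\}$. For an integer $i\ge 0$, an $(i)$-split of $P$ consists of subpaths $Q_1,\dots,Q_i$ of $P$, a subpath $P_i$ of $P$, brambles $\mathcal B_1,\dots,\mathcal B_i$, vertices $a_1,\dots,a_i$, and a vertex set $X_i$ such that: (1) for $j\in[i]$, $a_j$ is the successor in $P$ of the last vertex of $Q_j$, and for $j\le i-1$ the first vertex of $Q_{j+1}$ is the successor in $P$ of $a_j$; (2) $\mathrm{ord}(\mathcal B_j)\ge\lfloor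 k/2\rfloor$ for $j\in[i]$; (3) $\mathcal B_j\subseteq\mathcal B_T$ and $V(Q_j)$ is a hitting set of $\mathcal B_j$ for $j\in[i]$; (4) $X_i=\bigcup_{j\in[i]}(V(Q_j)\cup\{a_j\})$ and $P_i$ is the subpath of $P$ with vertex set $V(P)\setminus X_i$, from the successor of $a_i$ to the last vertex of $P$ (for $i=0$: $X_0=\emptyset$, $P_0=P$); (5) $\mathrm{ord}(\overline{\mathcal B_T}(X_i))\ge g(k)-i(\lfloor k/2\rfloor+1)$. A set $A\subseteq V(D)$ is well-linked if for all disjoint $X,Y\subseteq A$ with $|X|=|Y|$ there are $|X|$ pairwise vertex-disjoint directed paths from $X$ to $Y$ in $D$. -}

module Defs where

open import Data.Nat.Base using (ℕ; zero; suc; _+_; _*_; _∸_; _≤_; ⌊_/2⌋)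
open import Data.Bool.Base using (Bool; true)
open import Data.Fin.Base using (Fin)
open import Data.Fin.Subset using (Subset; _∈_; _∉_; _⊆_; ⁅_⁆; _∪_; _∩_; ∁; ∣_∣)
                            renaming (⊥ to ∅)
open import Data.List.Base using (List; []; _∷_; _++_; [_]; map; concat; allFin; foldr; head; last)
open import Data.List.Relation.Unary.Linked using (Linked)
open import Data.List.Relation.Unary.Unique.Propositional using (Unique)
open import Data.Maybe.Base using (just)
open import Data.Product using (Σ; _×_; ∃)
open import Data.Sum using (_⊎_)
open import Relation.Binary.PropositionalEquality using (_≡_; _≢_)

Adj : ℕ → Set
Adj n = Fin n → Fin n → Bool

Arc : ∀ {n} → Adj n → Fin n → Fin n → Set
Arc E u v = E u v ≡ true

g : ℕ → ℕ
g k = (k + 1) * (⌊ k /2⌋ + 1) ∸ 1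

toSubset : ∀ {n} → List (Fin n) → Subset n
toSubset = foldr (λ x s → ⁅ x ⁆ ∪ s) ∅

-- Reachability inside the induced subgraph D[S] (by directed walks,
-- all of whose vertices lie in S).

data Reach {n} (E : Adj n) (S : Subset n) : Fin n → Fin n → Set where
  here : ∀ {u} → u ∈ S → Reach E S u u
  step : ∀ {u w v} → u ∈ S → Arc E u w → Reach E S w v → Reach E S u v

StronglyConnected : ∀ {n} → Adj n → Subset n → Set
StronglyConnected E S =
  (∃ λ v → v ∈ S) × (∀ u v → u ∈ S → v ∈ S → Reach E S u v)

IsStrongComponent : ∀ {n} → Adj n → Subset n → Subset n → Set
IsStrongComponent E S C =
  Σ _ λ v → v ∈ S ×
    (∀ u → (u ∈ C → Reach E S v u × Reach E S u v)
         × (Reach E S v u × Reach E S u v → u ∈ C))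

BalancedSeparator : ∀ {n} → Adj n → Subset n → ℕ → Subset n → Set
BalancedSeparator E T r Z =
  ∀ C → IsStrongComponent E (∁ Z) C → ∣ C ∩ T ∣ ≤ r

IsLinked : ∀ {n} → Adj n → Subset n → ℕ → ℕ → Set
IsLinked E T k′ r = ∀ Z → BalancedSeparator E T r Z → suc k′ ≤ ∣ Z ∣

-- a family of (induced) subgraphs, given by their vertex sets
Family : ℕ → Set₁
Family n = Subset n → Set

Touch : ∀ {n} → Adj n → Subset n → Subset n → Set
Touch E S S′ =
  (∃ λ v → v ∈ S × v ∈ S′)
  ⊎ ((∃ λ u → ∃ λ v → u ∈ S × v ∈ S′ × Arc E u v)
   × (∃ λ u → ∃ λ v → u ∈ S′ × v ∈ S × Arc E u v))

IsBramble : ∀ {n} → Adj n → Family n → Set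
IsBramble E ℬ =
  (∀ S → ℬ S → StronglyConnected E S)
  × (∀ S S′ → ℬ S → ℬ S′ → Touch E S S′)

Hits : ∀ {n} → Family n → Subset n → Set
Hits ℬ H = ∀ S → ℬ S → ∃ λ v → v ∈ S × v ∈ H

OrderAtLeast : ∀ {n} → Family n → ℕ → Set
OrderAtLeast ℬ m = ∀ H → Hits ℬ H → m ≤ ∣ H ∣

_⊆ᶠ_ : ∀ {n} → Family n → Family n → Set
ℬ ⊆ᶠ ℬ′ = ∀ S → ℬ S → ℬ′ S

TBramble : ∀ {n} → Adj n → Subset n → ℕ → Family n
TBramble E T m S = StronglyConnected E S × m ≤ ∣ S ∩ T ∣

Avoiding : ∀ {n} → Family n → Subset n → Family n
Avoiding ℬ X S = ℬ S × (∀ v → v ∈ S → v ∉ X)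

IsDPath : ∀ {n} → Adj n → List (Fin n) → Set
IsDPath E p = p ≢ [] × Unique p × Linked (Arc E) p

IsDPathFromTo : ∀ {n} → Adj n → Subset n → Subset n → List (Fin n) → Set
IsDPathFromTo E X Y p =
  IsDPath E p
  × (∃ λ x → head p ≡ just x × x ∈ X)
  × (∃ λ y → last p ≡ just y × y ∈ Y)

Disjoint : ∀ {n} → Subset n → Subset n → Set
Disjoint X Y = ∀ v → v ∈ X → v ∉ Y

WellLinked : ∀ {n} → Adj n → Subset n → Set
WellLinked {n} E A =
  ∀ X Y → X ⊆ A → Y ⊆ A → Disjoint X Y → ∣ X ∣ ≡ ∣ Y ∣ →
  Σ (Fin ∣ X ∣ → List (Fin n)) λ paths →
    (∀ j → IsDPathFromTo E X Y (paths j))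
    × (∀ j j′ → j ≢ j′ → Disjoint (toSubset (paths j)) (toSubset (paths j′)))

blocks : ∀ {n} i → (Fin i → List (Fin n)) → (Fin i → Fin n) → List (Fin n)
blocks i Q a = concat (map (λ j → Q j ++ [ a j ]) (allFin i))

record Split {n} (E : Adj n) (T : Subset n) (k : ℕ) (P : List (Fin n)) (i : ℕ) : Set₁ where
  field
    Q  : Fin i → List (Fin n)
    a  : Fin i → Fin n
    ℬ  : Fin i → Family n
    Pᵢ : List (Fin n)
    Q-nonempty : ∀ j → Q j ≢ []
    decomp     : P ≡ blocks i Q a ++ Pᵢ
    ℬ-bramble  : ∀ j → IsBramble E (ℬ j)
    ℬ-order    : ∀ j → OrderAtLeast (ℬ j) ⌊ k /2⌋
    ℬ-sub      : ∀ j → ℬ j ⊆ᶠ TBramble E T (g k)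
    Q-hits     : ∀ j → Hits (ℬ j) (toSubset (Q j))
    rest-order : OrderAtLeast (Avoiding (TBramble E T (g k)) (toSubset (blocks i Q a)))
                              (g k ∸ i * (⌊ k /2⌋ + 1))

splitVertices : ∀ {n E T k P i} → Split {n} E T k P i → Subset n
splitVertices {i = i} s = toSubset (map (Split.a s) (allFin i))

module Submission where

-- Let X, Y ⊆ A be disjoint with |X| = |Y|.  By Menger's theorem it suffices
-- to refute a set S with |S| < |X| meeting every X–Y path.  Since
-- |X| + |Y| ≤ |A| ≤ i ≤ k we get |S| < ⌊k/2⌋, which is below the order of
-- every ℬⱼ and of ℬ̄_T(Xᵢ); so S misses some Bⱼ ∈ ℬⱼ and some B ∈ ℬ̄_T(Xᵢ).
-- Qⱼ hits Bⱼ in a hub cⱼ and Pᵢ hits B in a hub c_{i+1}.  As |T| = 2g(k) − 1,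
-- any two members of the T-bramble intersect, so all hubs are mutually
-- reachable in D − S.  Along P we have c₁ < a₁ < c₂ < … < aᵢ < c_{i+1}; the
-- segments [cⱼ, cⱼ₊₁] share only hubs, so S meets at most |S| < |X| of them.
-- Hence some x ∈ X and some y ∈ Y have S-free segments, and x → hub → hub → y
-- is an X–Y walk in D − S, a contradiction.

open import Defs
open import Data.Nat.Base using (ℕ; _*_; _∸_; _≤_)
open import Data.Fin.Subset using (Subset; ∣_∣)
open import Data.List.Base using (List)
open import Data.Fin.Base using (Fin)
open import Relation.Binary.PropositionalEquality using (_≡_)

open import Data.Nat.Base using (zero; suc; _+_; _<_; z≤n; s≤s; ⌊_/2⌋)
import Data.Nat.Properties as ℕP
open import Data.Nat.Solver using (module +-*-Solver)
open import Data.Fin.Base using (zero; suc; toℕ; fromℕ<; inject≤; cast)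
import Data.Fin.Properties as FinP
open import Data.Fin.Subset using (_∈_; _⊆_; _∩_; ∁; ⁅_⁆)
import Data.Fin.Subset.Properties as SubP
open import Data.Bool.Base using (true; false)
import Data.Bool.Properties as BoolP
open import Data.Vec.Base using ([]; _∷_; here; there)
open import Data.List.Base using ([]; _∷_; _++_; [_]; length; lookup; filter; allFin; map; concat; last; cartesianProduct)
open import Data.List.Properties using (++-assoc; filter-notAll; length-map; length-++; length-tabulate; map-tabulate)
open import Data.List.Relation.Unary.Linked as Linked using (Linked; []; [-]; _∷_)
open import Data.List.Relation.Unary.Unique.Propositional using (Unique)
import Data.List.Relation.Unary.Unique.Propositional.Properties as UniqueP
open import Data.List.Relation.Unary.AllPairs using ([]; _∷_)
open import Data.List.Relation.Unary.All as All using (All; []; _∷_)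
import Data.List.Relation.Unary.All.Properties as AllP
open import Data.List.Relation.Unary.Any as Any using (Any; here; there)
open import Data.List.Relation.Unary.Any.Properties using (lookup-index)
open import Data.List.Membership.Propositional using (find) renaming (_∈_ to _∈ₗ_; _∉_ to _∉ₗ_)
open import Data.List.Membership.Propositional.Properties
  using (∈-++⁺ˡ; ∈-++⁺ʳ; ∈-++⁻; ∈-∃++; ∈-map⁺; ∈-map⁻; ∈-filter⁺; ∈-filter⁻; ∈-allFin; ∈-cartesianProduct⁺)
open import Data.Maybe.Base using (just)
open import Data.Product using (Σ; ∃; ∃₂; _×_; _,_; proj₁; proj₂)
open import Data.Sum using (_⊎_; inj₁; inj₂)
open import Data.Empty using (⊥; ⊥-elim)
open import Function.Base using (id)
open import Relation.Nullary using (¬_; Dec; yes; no; ¬?; _×-dec_)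
open import Relation.Binary.Definitions using (tri<; tri≈; tri>)
open import Relation.Binary.PropositionalEquality using (_≢_; refl; sym; trans; cong; cong₂; subst; subst₂; module ≡-Reasoning)

module _ {V : Set} where

  HeadIn : (V → Set) → List V → Set
  HeadIn A []      = ⊥
  HeadIn A (x ∷ _) = A x

  LastIn : (V → Set) → List V → Set
  LastIn B []          = ⊥
  LastIn B (x ∷ [])    = B x
  LastIn B (x ∷ y ∷ l) = LastIn B (y ∷ l)

  headIn-swap : ∀ {A} l {v} m m′ → HeadIn A (l ++ v ∷ m) → HeadIn A (l ++ v ∷ m′)
  headIn-swap []      m m′ h = h
  headIn-swap (x ∷ l) m m′ h = h

  lastIn-++⁺ : ∀ {B} l {v} m → LastIn B (v ∷ m) → LastIn B (l ++ v ∷ m)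
  lastIn-++⁺ []          m h = h
  lastIn-++⁺ (x ∷ [])    m h = h
  lastIn-++⁺ (x ∷ y ∷ l) m h = lastIn-++⁺ (y ∷ l) m h

  lastIn-++⁻ : ∀ {B} l {v} m → LastIn B (l ++ v ∷ m) → LastIn B (v ∷ m)
  lastIn-++⁻ []          m h = h
  lastIn-++⁻ (x ∷ [])    m h = h
  lastIn-++⁻ (x ∷ y ∷ l) m h = lastIn-++⁻ (y ∷ l) m h

  lastIn⇒∈ : ∀ {B} l → LastIn B l → ∃ λ w → w ∈ₗ l × B w
  lastIn⇒∈ (x ∷ [])    h = x , here refl , h
  lastIn⇒∈ (x ∷ y ∷ l) h with lastIn⇒∈ (y ∷ l) h
  ... | w , w∈ , b = w , there w∈ , b

  lastIn⇒last : ∀ {B} l → LastIn B l → ∃ λ y → last l ≡ just y × B y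
  lastIn⇒last (x ∷ [])    b = x , refl , b
  lastIn⇒last (x ∷ y ∷ l) b = lastIn⇒last (y ∷ l) b

  linked-glue : ∀ {R : V → V → Set} l {v} m →
                Linked R (l ++ [ v ]) → Linked R (v ∷ m) → Linked R (l ++ v ∷ m)
  linked-glue []          m _       h = h
  linked-glue (x ∷ [])    m (r ∷ _) h = r ∷ h
  linked-glue (x ∷ y ∷ l) m (r ∷ t) h = r ∷ linked-glue (y ∷ l) m t h

  linked-prefix : ∀ {R : V → V → Set} l {v} m → Linked R (l ++ v ∷ m) → Linked R (l ++ [ v ])
  linked-prefix []          m _       = [-]
  linked-prefix (x ∷ [])    m (r ∷ _) = r ∷ [-]
  linked-prefix (x ∷ y ∷ l) m (r ∷ t) = r ∷ linked-prefix (y ∷ l) m t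

  linked-suffix : ∀ {R : V → V → Set} l {v} m → Linked R (l ++ v ∷ m) → Linked R (v ∷ m)
  linked-suffix []      m h = h
  linked-suffix (x ∷ l) m h = linked-suffix l m (Linked.tail h)

  unique-++ˡ : ∀ (l m : List V) → Unique (l ++ m) → Unique l
  unique-++ˡ []      m _        = []
  unique-++ˡ (x ∷ l) m (px ∷ u) = AllP.++⁻ˡ l px ∷ unique-++ˡ l m u

  unique-++ʳ : ∀ (l m : List V) → Unique (l ++ m) → Unique m
  unique-++ʳ []      m u       = u
  unique-++ʳ (x ∷ l) m (_ ∷ u) = unique-++ʳ l m u

  unique-prefix : ∀ l {v} m → Unique (l ++ v ∷ m) → Unique (l ++ [ v ])
  unique-prefix l {v} m u = unique-++ˡ (l ++ [ v ]) m (subst Unique (sym (++-assoc l [ v ] m)) u)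

  unique-++ : ∀ (l m : List V) → Unique l → Unique m → (∀ {w} → w ∈ₗ l → w ∈ₗ m → ⊥) → Unique (l ++ m)
  unique-++ l m ul um disj = UniqueP.++⁺ ul um (λ (wl , wm) → disj wl wm)

  ∈-prefix : ∀ (l : List V) {v m w} → w ∈ₗ l ++ [ v ] → w ∈ₗ l ++ v ∷ m
  ∈-prefix l w∈ with ∈-++⁻ l w∈
  ... | inj₁ wl         = ∈-++⁺ˡ wl
  ... | inj₂ (here w≡v) = ∈-++⁺ʳ l (here w≡v)

  lookup∈ : ∀ (l : List V) i → lookup l i ∈ₗ l
  lookup∈ (x ∷ l) zero    = here refl
  lookup∈ (x ∷ l) (suc i) = there (lookup∈ l i)

  lookup-injective : ∀ (l : List V) → Unique l → ∀ i j → lookup l i ≡ lookup l j → i ≡ j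
  lookup-injective (x ∷ l) u        zero    zero    e = refl
  lookup-injective (x ∷ l) (px ∷ u) zero    (suc j) e = ⊥-elim (All.lookup px (lookup∈ l j) e)
  lookup-injective (x ∷ l) (px ∷ u) (suc i) zero    e = ⊥-elim (All.lookup px (lookup∈ l i) (sym e))
  lookup-injective (x ∷ l) (_ ∷ u)  (suc i) (suc j) e = cong suc (lookup-injective l u i j e)

  pigeonhole : ∀ {k} (l : List V) → length l < k → (f : Fin k → V) → (∀ j → f j ∈ₗ l) →
               ∃₂ λ a b → a ≢ b × f a ≡ f b
  pigeonhole l short f f∈ with FinP.pigeonhole short (λ j → Any.index (f∈ j))
  ... | a , b , a<b , same = a , b , (λ a≡b → FinP.<-irrefl a≡b a<b) ,
         trans (lookup-index (f∈ a)) (trans (cong (lookup l) same) (sym (lookup-index (f∈ b))))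

  unique-length : ∀ (l l′ : List V) → Unique l → (∀ {v} → v ∈ₗ l → v ∈ₗ l′) → length l ≤ length l′
  unique-length l l′ u sub with length l ℕP.≤? length l′
  ... | yes le = le
  ... | no nle with pigeonhole l′ (ℕP.≰⇒> nle) (lookup l) (λ j → sub (lookup∈ l j))
  ...   | a , b , a≢b , same = ⊥-elim (a≢b (lookup-injective l u a b same))

  firstSplit : ∀ {P : V → Set} → (∀ v → Dec (P v)) → ∀ l {w} → w ∈ₗ l → P w →
    Σ (List V) λ pre → Σ V λ v → Σ (List V) λ post →
      l ≡ pre ++ v ∷ post × All (λ z → ¬ P z) pre × P v
  firstSplit P? (u ∷ l) w∈ pw with P? u
  ... | yes pu = [] , u , l , refl , [] , pu
  firstSplit P? (u ∷ l) (here refl) pw | no ¬pu = ⊥-elim (¬pu pw)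
  firstSplit P? (u ∷ l) (there w∈) pw  | no ¬pu with firstSplit P? l w∈ pw
  ... | pre , v , post , eq , ¬P , pv = u ∷ pre , v , post , cong (u ∷_) eq , ¬pu ∷ ¬P , pv

  lastSplit : ∀ {P : V → Set} → (∀ v → Dec (P v)) → ∀ l {w} → w ∈ₗ l → P w →
    Σ (List V) λ pre → Σ V λ v → Σ (List V) λ post →
      l ≡ pre ++ v ∷ post × All (λ z → ¬ P z) post × P v
  lastSplit P? (u ∷ l) w∈ pw with Any.any? P? l
  ... | yes later with find later
  ...   | w′ , w′∈ , pw′ with lastSplit P? l w′∈ pw′
  ...     | pre , v , post , eq , ¬P , pv = u ∷ pre , v , post , cong (u ∷_) eq , ¬P , pv
  lastSplit P? (u ∷ l) (here refl) pw | no none = [] , u , l , refl , AllP.¬Any⇒All¬ l none , pw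
  lastSplit P? (u ∷ l) (there w∈) pw  | no none = ⊥-elim (none (Any.map (λ { refl → pw }) w∈))

injection-onto : ∀ {n k} (l : List (Fin n)) → length l ≤ k → (f : Fin k → Fin n) → (∀ j → f j ∈ₗ l) →
                 (∀ a b → f a ≡ f b → a ≡ b) → ∀ v → v ∈ₗ l → ∃ λ j → f j ≡ v
injection-onto {k = k} l le f f∈ inj v v∈ with FinP.any? (λ j → f j FinP.≟ v)
... | yes hit = hit
... | no miss with pigeonhole (filter (λ w → ¬? (w FinP.≟ v)) l) shorter f others
  where
    shorter : length (filter (λ w → ¬? (w FinP.≟ v)) l) < k
    shorter = ℕP.<-≤-trans (filter-notAll (λ w → ¬? (w FinP.≟ v)) l (Any.map (λ v≡ w≢ → w≢ (sym v≡)) v∈)) le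
    others : ∀ j → f j ∈ₗ filter (λ w → ¬? (w FinP.≟ v)) l
    others j = ∈-filter⁺ (λ w → ¬? (w FinP.≟ v)) (f∈ j) (λ fj≡v → miss (j , fj≡v))
...   | a , b , a≢b , same = ⊥-elim (a≢b (inj a b same))

-- Menger's theorem for a finite digraph on Fin n whose arcs are listed in
-- L: for decidable vertex sets A, B and every k there are k pairwise
-- disjoint A–B paths, or fewer than k vertices meet every A–B path.  When the arc x → y is added to a graph
-- with a separator S (|S| < k) that no longer separates, both S ∪ {x}
-- and S ∪ {y} separate; applying induction to A–(S ∪ {x}) and (S ∪ {y})–B
-- either yields a small separator or k paths of each kind, which are
-- trimmed at their first/last visit and glued together along the
-- matching x ↦ y, s ↦ s.
module Menger {n : ℕ} where

  private
    V = Fin n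

  _∈?_ : ∀ (v : V) l → Dec (v ∈ₗ l)
  v ∈? l = Any.any? (v FinP.≟_) l

  ArcsOf : List (V × V) → V → V → Set
  ArcsOf L u v = (u , v) ∈ₗ L

  Separates : (V → V → Set) → (V → Set) → (V → Set) → List V → Set
  Separates R A B S = ∀ l → Linked R l → HeadIn A l → LastIn B l → ∃ λ w → w ∈ₗ l × w ∈ₗ S

  PathFromTo : (V → V → Set) → (V → Set) → (V → Set) → List V → Set
  PathFromTo R A B l = Linked R l × Unique l × HeadIn A l × LastIn B l

  PairwiseDisjoint : ∀ {k} → (Fin k → List V) → Set
  PairwiseDisjoint p = ∀ a b → a ≢ b → ∀ {w} → w ∈ₗ p a → w ∈ₗ p b → ⊥

  DisjointPaths : (V → V → Set) → (V → Set) → (V → Set) → ℕ → Set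
  DisjointPaths R A B k = Σ (Fin k → List V) λ p → (∀ j → PathFromTo R A B (p j)) × PairwiseDisjoint p

  SmallSeparator : (V → V → Set) → (V → Set) → (V → Set) → ℕ → Set
  SmallSeparator R A B k = Σ (List V) λ S → length S < k × Separates R A B S

  -- without arcs, the A–B paths are the single vertices of A ∩ B
  menger-noArcs : ∀ {A B} → (∀ v → Dec (A v)) → (∀ v → Dec (B v)) → ∀ k →
                  DisjointPaths (ArcsOf []) A B k ⊎ SmallSeparator (ArcsOf []) A B k
  menger-noArcs {A} {B} A? B? k with k ℕP.≤? length (filter (λ v → A? v ×-dec B? v) (allFin n))
  ... | yes enough = inj₁ (p , (λ j → [-] , ([] ∷ []) , proj₁ (inAB j) , proj₂ (inAB j)) , disjoint)
    where
      AB = filter (λ v → A? v ×-dec B? v) (allFin n)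
      c : Fin k → V
      c j = lookup AB (inject≤ j enough)
      p : Fin k → List V
      p j = [ c j ]
      inAB : ∀ j → A (c j) × B (c j)
      inAB j = proj₂ (∈-filter⁻ (λ v → A? v ×-dec B? v) {xs = allFin n} (lookup∈ AB (inject≤ j enough)))
      disjoint : PairwiseDisjoint p
      disjoint a b a≢b (here refl) (here same) =
        a≢b (FinP.inject≤-injective enough enough a b
               (lookup-injective AB (UniqueP.filter⁺ (λ v → A? v ×-dec B? v) (UniqueP.allFin⁺ n)) _ _ same))
  ... | no few = inj₂ (filter (λ v → A? v ×-dec B? v) (allFin n) , ℕP.≰⇒> few , separates)
    where
      separates : Separates (ArcsOf []) A B (filter (λ v → A? v ×-dec B? v) (allFin n))
      separates (u ∷ [])    _        a b = u , here refl , ∈-filter⁺ (λ v → A? v ×-dec B? v) (∈-allFin u) (a , b)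
      separates (u ∷ v ∷ l) (() ∷ _) _ _

  module AddArc {x y : V} {L′ : List (V × V)} where
    R⁺ = ArcsOf ((x , y) ∷ L′)
    R  = ArcsOf L′

    lift : ∀ {l} → Linked R l → Linked R⁺ l
    lift = Linked.map there

    avoidsOrUses : ∀ l → Linked R⁺ l → Linked R l ⊎ (x ∈ₗ l × y ∈ₗ l)
    avoidsOrUses []          []             = inj₁ []
    avoidsOrUses (u ∷ [])    [-]            = inj₁ [-]
    avoidsOrUses (u ∷ v ∷ l) (here uv≡ ∷ t) =
      inj₂ (here (sym (cong proj₁ uv≡)) , there (here (sym (cong proj₂ uv≡))))
    avoidsOrUses (u ∷ v ∷ l) (there r ∷ t) with avoidsOrUses (v ∷ l) t
    ... | inj₁ t′       = inj₁ (r ∷ t′)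
    ... | inj₂ (xl , yl) = inj₂ (there xl , there yl)

    separates-with-x : ∀ {A B S} → Separates R A B S → Separates R⁺ A B (x ∷ S)
    separates-with-x sep l lk a b with avoidsOrUses l lk
    ... | inj₁ lk′      = let w , wl , wS = sep l lk′ a b in w , wl , there wS
    ... | inj₂ (xl , _) = x , xl , here refl

    separates-with-y : ∀ {A B S} → Separates R A B S → Separates R⁺ A B (y ∷ S)
    separates-with-y sep l lk a b with avoidsOrUses l lk
    ... | inj₁ lk′      = let w , wl , wS = sep l lk′ a b in w , wl , there wS
    ... | inj₂ (_ , yl) = y , yl , here refl

    separates-if-x∈ : ∀ {A B S} → x ∈ₗ S → Separates R A B S → Separates R⁺ A B S
    separates-if-x∈ x∈S sep l lk a b with avoidsOrUses l lk
    ... | inj₁ lk′      = sep l lk′ a b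
    ... | inj₂ (xl , _) = x , xl , x∈S

    separates-if-y∈ : ∀ {A B S} → y ∈ₗ S → Separates R A B S → Separates R⁺ A B S
    separates-if-y∈ y∈S sep l lk a b with avoidsOrUses l lk
    ... | inj₁ lk′      = sep l lk′ a b
    ... | inj₂ (_ , yl) = y , yl , y∈S

    removeLoops : ∀ {B} → x ≡ y → ∀ u t → Linked R⁺ (u ∷ t) → LastIn B (u ∷ t) →
                  Σ (List V) λ t′ → Linked R (u ∷ t′) × LastIn B (u ∷ t′) × (∀ {w} → w ∈ₗ t′ → w ∈ₗ t)
    removeLoops x≡y u []      lk lb = [] , [-] , lb , λ ()
    removeLoops x≡y u (v ∷ t) (here uv≡ ∷ lk) lb with removeLoops x≡y v t lk lb
    ... | t′ , lk′ , lb′ , sub with trans (cong proj₁ uv≡) (trans x≡y (sym (cong proj₂ uv≡)))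
    ...   | refl = t′ , lk′ , lb′ , λ w∈ → there (sub w∈)
    removeLoops x≡y u (v ∷ t) (there r ∷ lk) lb with removeLoops x≡y v t lk lb
    ... | t′ , lk′ , lb′ , sub =
      v ∷ t′ , r ∷ lk′ , lb′ , λ { (here w≡) → here w≡ ; (there w∈) → there (sub w∈) }

    separates-loop : ∀ {A B S} → x ≡ y → Separates R A B S → Separates R⁺ A B S
    separates-loop x≡y sep (u ∷ t) lk a b with removeLoops x≡y u t lk b
    ... | t′ , lk′ , lb′ , sub with sep (u ∷ t′) lk′ a lb′
    ...   | w , here w≡ , wS  = w , here w≡ , wS
    ...   | w , there w∈ , wS = w , there (sub w∈) , wS

    old-arc-from : ∀ {u v} → R⁺ u v → u ≢ x → R u v
    old-arc-from (here uv≡) u≢x = ⊥-elim (u≢x (cong proj₁ uv≡))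
    old-arc-from (there r)  _   = r

    old-arc-to : ∀ {u v} → R⁺ u v → v ≢ y → R u v
    old-arc-to (here uv≡) v≢y = ⊥-elim (v≢y (cong proj₂ uv≡))
    old-arc-to (there r)  _   = r

    old-prefix : ∀ l {v} → Linked R⁺ (l ++ [ v ]) → All (_≢ x) l → Linked R (l ++ [ v ])
    old-prefix []          _       _          = [-]
    old-prefix (u ∷ [])    (r ∷ [-]) (u≢ ∷ []) = old-arc-from r u≢ ∷ [-]
    old-prefix (u ∷ w ∷ l) (r ∷ t) (u≢ ∷ ns)  = old-arc-from r u≢ ∷ old-prefix (w ∷ l) t ns

    old-suffix : ∀ {v} l → Linked R⁺ (v ∷ l) → All (_≢ y) l → Linked R (v ∷ l)
    old-suffix []      _       _          = [-]
    old-suffix (w ∷ l) (r ∷ t) (w≢ ∷ ns) = old-arc-to r w≢ ∷ old-suffix l t ns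

    -- an old separator between A and S ∪ {x} separates A from B in the new
    -- graph: cut a new A–B path at its first vertex of S ∪ {x}
    separator-before : ∀ {A B S S′} → Separates R⁺ A B (x ∷ S) → Separates R A (_∈ₗ x ∷ S) S′ →
                       Separates R⁺ A B S′
    separator-before {S = S} sep⁺ sep′ l lk a b with sep⁺ l lk a b
    ... | w , wl , wX with firstSplit (_∈? (x ∷ S)) l wl wX
    ...   | pre , v , post , refl , before , vX with sep′ (pre ++ [ v ])
              (old-prefix pre (linked-prefix pre post lk) (All.map (λ ∉X v≡x → ∉X (here v≡x)) before))
              (headIn-swap pre post [] a) (lastIn-++⁺ pre [] vX)
    ...     | z , zl , zS = z , ∈-prefix pre zl , zS

    -- symmetrically for separators between S ∪ {y} and B, cutting at the last visit
    separator-after : ∀ {A B S S′} → Separates R⁺ A B (y ∷ S) → Separates R (_∈ₗ y ∷ S) B S′ →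
                      Separates R⁺ A B S′
    separator-after {S = S} sep⁺ sep′ l lk a b with sep⁺ l lk a b
    ... | w , wl , wY with lastSplit (_∈? (y ∷ S)) l wl wY
    ...   | pre , v , post , refl , after , vY with sep′ (v ∷ post)
              (old-suffix post (linked-suffix pre post lk) (All.map (λ ∉Y v≡y → ∉Y (here v≡y)) after))
              vY (lastIn-++⁻ pre post b)
    ...     | z , zl , zS = z , ∈-++⁺ʳ pre zl , zS

    record PathInto (A : V → Set) (X : List V) : Set where
      field
        body      : List V
        end       : V
        linked    : Linked R (body ++ [ end ])
        unique    : Unique (body ++ [ end ])
        starts    : HeadIn A (body ++ [ end ])
        end∈X     : end ∈ₗ X
        body∉X    : All (_∉ₗ X) body
      vertices : List V
      vertices = body ++ [ end ]

    record PathOutOf (X : List V) (B : V → Set) : Set where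
      field
        start     : V
        body      : List V
        linked    : Linked R (start ∷ body)
        unique    : Unique (start ∷ body)
        ends      : LastIn B (start ∷ body)
        start∈X   : start ∈ₗ X
        body∉X    : All (_∉ₗ X) body
      vertices : List V
      vertices = start ∷ body

    open PathInto using (end; end∈X)
    open PathOutOf using (start; start∈X)

    trimInto : ∀ {A} X l → PathFromTo R A (_∈ₗ X) l →
               Σ (PathInto A X) λ f → ∀ {w} → w ∈ₗ PathInto.vertices f → w ∈ₗ l
    trimInto X l (lk , u , hd , la) with lastIn⇒∈ l la
    ... | w , wl , wX with firstSplit (_∈? X) l wl wX
    ...   | pre , v , post , refl , before , vX =
      record { body = pre ; end = v ; linked = linked-prefix pre post lk ; unique = unique-prefix pre post u
             ; starts = headIn-swap pre post [] hd ; end∈X = vX ; body∉X = before } ,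
      ∈-prefix pre

    trimOutOf : ∀ {B} X l → PathFromTo R (_∈ₗ X) B l →
                Σ (PathOutOf X B) λ b → ∀ {w} → w ∈ₗ PathOutOf.vertices b → w ∈ₗ l
    trimOutOf X (u ∷ t) (lk , un , hd , la) with lastSplit (_∈? X) (u ∷ t) (here refl) hd
    ... | pre , v , post , eq , after , vX rewrite eq =
      record { start = v ; body = post ; linked = linked-suffix pre post lk ; unique = unique-++ʳ pre _ un
             ; ends = lastIn-++⁻ pre post la ; start∈X = vX ; body∉X = after } ,
      ∈-++⁺ʳ pre

    prefixUpTo : ∀ {A} {Q : V → Set} body end → Linked R (body ++ [ end ]) → HeadIn A (body ++ [ end ]) →
                 All Q body → ∀ {v} → v ∈ₗ body ++ [ end ] →
                 Σ (List V) λ α → Linked R (α ++ [ v ]) × HeadIn A (α ++ [ v ]) × All Q α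
    prefixUpTo body end lk hd qs v∈ with ∈-++⁻ body v∈
    ... | inj₂ (here refl) = body , lk , hd , qs
    ... | inj₁ v∈body with ∈-∃++ v∈body
    ...   | α , β , refl =
      α , linked-prefix α (β ++ [ end ]) (subst (Linked R) (++-assoc α (_ ∷ β) [ end ]) lk) ,
      headIn-swap α (β ++ [ end ]) [] (subst (HeadIn _) (++-assoc α (_ ∷ β) [ end ]) hd) ,
      AllP.++⁻ˡ α qs

    suffixFrom : ∀ {B} {Q : V → Set} start body → Linked R (start ∷ body) → LastIn B (start ∷ body) →
                 All Q body → ∀ {v} → v ∈ₗ start ∷ body →
                 Σ (List V) λ δ → Linked R (v ∷ δ) × LastIn B (v ∷ δ) × All Q δ
    suffixFrom start body lk la qs (here refl) = body , lk , la , qs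
    suffixFrom start body lk la qs (there v∈) with ∈-∃++ v∈
    ... | γ , δ , refl = δ , linked-suffix (start ∷ γ) δ lk , lastIn-++⁻ (start ∷ γ) δ la ,
                         All.tail (AllP.++⁻ʳ γ qs)

    module Glue {A B : V → Set} {S : List V} {k : ℕ}
      (x∉S : x ∉ₗ S) (y∉S : y ∉ₗ S) (sep : Separates R A B S) (few : length (y ∷ S) ≤ k)
      (into : Fin k → PathInto A (x ∷ S))
      (into-disjoint : PairwiseDisjoint (λ j → PathInto.vertices (into j)))
      (out : Fin k → PathOutOf (y ∷ S) B)
      (out-disjoint : PairwiseDisjoint (λ j → PathOutOf.vertices (out j)))
      where

      -- a front part and a back part can only share vertices of S, since
      -- otherwise they combine into an old A–B path avoiding S
      shared∈S : ∀ (f : PathInto A (x ∷ S)) (b : PathOutOf (y ∷ S) B) {w} →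
                 w ∈ₗ PathInto.vertices f → w ∈ₗ PathOutOf.vertices b → w ∈ₗ S
      shared∈S f b {w} wf wb with w ∈? S
      ... | yes w∈S = w∈S
      ... | no w∉S with prefixUpTo (PathInto.body f) (end f) (PathInto.linked f) (PathInto.starts f) (PathInto.body∉X f) wf
                      | suffixFrom (start b) (PathOutOf.body b) (PathOutOf.linked b) (PathOutOf.ends b) (PathOutOf.body∉X b) wb
      ...   | α , lk₁ , hd , α∉ | δ , lk₂ , la , δ∉
              with sep (α ++ w ∷ δ) (linked-glue α δ lk₁ lk₂) (headIn-swap α [] δ hd) (lastIn-++⁺ α δ la)
      ...     | z , zl , zS with ∈-++⁻ α zl
      ...       | inj₁ zα         = ⊥-elim (All.lookup α∉ zα (there zS))
      ...       | inj₂ (here refl) = ⊥-elim (w∉S zS)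
      ...       | inj₂ (there zδ)  = ⊥-elim (All.lookup δ∉ zδ (there zS))

      -- the end e of a front part is continued by a back part starting at partner e
      partner : ∀ {e} → e ∈ₗ x ∷ S → V
      partner (here _)      = y
      partner {e} (there _) = e

      partner∈ : ∀ {e} (p : e ∈ₗ x ∷ S) → partner p ∈ₗ y ∷ S
      partner∈ (here _)  = here refl
      partner∈ (there p) = there p

      partner-injective : ∀ {e e′} (p : e ∈ₗ x ∷ S) (q : e′ ∈ₗ x ∷ S) → partner p ≡ partner q → e ≡ e′
      partner-injective (here p)  (here q)  _    = trans p (sym q)
      partner-injective (here p)  (there q) same = ⊥-elim (y∉S (subst (_∈ₗ S) (sym same) q))
      partner-injective (there p) (here q)  same = ⊥-elim (y∉S (subst (_∈ₗ S) same p))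
      partner-injective (there p) (there q) same = same

      start-injective : ∀ a b → start (out a) ≡ start (out b) → a ≡ b
      start-injective a b same with a FinP.≟ b
      ... | yes a≡b = a≡b
      ... | no a≢b  = ⊥-elim (out-disjoint a b a≢b (here refl) (here same))

      end-injective : ∀ a b → end (into a) ≡ end (into b) → a ≡ b
      end-injective a b same with a FinP.≟ b
      ... | yes a≡b = a≡b
      ... | no a≢b  = ⊥-elim (into-disjoint a b a≢b (∈-++⁺ʳ (PathInto.body (into a)) (here refl))
                                                    (∈-++⁺ʳ (PathInto.body (into b)) (here same)))

      matched : ∀ j → ∃ λ i → start (out i) ≡ partner (end∈X (into j))
      matched j = injection-onto (y ∷ S) few (λ i → start (out i)) (λ i → start∈X (out i)) start-injective
                    _ (partner∈ (end∈X (into j)))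

      σ : Fin k → Fin k
      σ j = proj₁ (matched j)

      σ-injective : ∀ a b → σ a ≡ σ b → a ≡ b
      σ-injective a b same = end-injective a b (partner-injective (end∈X (into a)) (end∈X (into b))
        (trans (sym (proj₂ (matched a))) (trans (cong (λ i → start (out i)) same) (proj₂ (matched b)))))

      Glued : PathInto A (x ∷ S) → PathOutOf (y ∷ S) B → Set
      Glued f b = Σ (List V) λ r → PathFromTo R⁺ A B r ×
                    (∀ {w} → w ∈ₗ r → w ∈ₗ PathInto.vertices f ⊎ (w ∈ₗ PathOutOf.vertices b × w ∉ₗ S))

      -- the continuation after the end e: all of b if e = x (via the new arc), its body otherwise
      continuation : (f : PathInto A (x ∷ S)) (b : PathOutOf (y ∷ S) B) (p : end f ∈ₗ x ∷ S) →
        start b ≡ partner p →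
        Σ (List V) λ mid → Linked R⁺ (end f ∷ mid) × LastIn B (end f ∷ mid) × Unique mid ×
          (∀ {w} → w ∈ₗ mid → w ∈ₗ PathOutOf.vertices b × w ∉ₗ S)
      continuation f b (here e≡x) st≡ =
        PathOutOf.vertices b , here (cong₂ _,_ e≡x st≡) ∷ lift (PathOutOf.linked b) , PathOutOf.ends b ,
        PathOutOf.unique b ,
        λ { (here refl) → here refl , λ st∈S → y∉S (subst (_∈ₗ S) st≡ st∈S)
          ; (there w∈) → there w∈ , λ w∈S → All.lookup (PathOutOf.body∉X b) w∈ (there w∈S) }
      continuation f b (there _) st≡ =
        PathOutOf.body b ,
        subst (λ z → Linked R⁺ (z ∷ PathOutOf.body b)) st≡ (lift (PathOutOf.linked b)) ,
        subst (λ z → LastIn B (z ∷ PathOutOf.body b)) st≡ (PathOutOf.ends b) ,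
        unique-++ʳ [ start b ] _ (PathOutOf.unique b) ,
        λ w∈ → there w∈ , λ w∈S → All.lookup (PathOutOf.body∉X b) w∈ (there w∈S)

      glue : ∀ (f : PathInto A (x ∷ S)) (b : PathOutOf (y ∷ S) B) (p : end f ∈ₗ x ∷ S) →
             start b ≡ partner p → Glued f b
      glue f b p st≡ with continuation f b p st≡
      ... | mid , lk , la , um , from =
        body ++ end f ∷ mid ,
        (linked-glue body mid (lift (PathInto.linked f)) lk ,
         subst Unique (++-assoc body [ end f ] mid)
           (unique-++ (body ++ [ end f ]) mid (PathInto.unique f) um
              (λ wf wm → proj₂ (from wm) (shared∈S f b wf (proj₁ (from wm))))) ,
         headIn-swap body [] mid (PathInto.starts f) ,
         lastIn-++⁺ body mid la) ,
        origin
        where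
          body = PathInto.body f
          origin : ∀ {w} → w ∈ₗ body ++ end f ∷ mid →
                   w ∈ₗ PathInto.vertices f ⊎ (w ∈ₗ PathOutOf.vertices b × w ∉ₗ S)
          origin w∈ with ∈-++⁻ body w∈
          ... | inj₁ w∈body      = inj₁ (∈-++⁺ˡ w∈body)
          ... | inj₂ (here w≡)   = inj₁ (∈-++⁺ʳ body (here w≡))
          ... | inj₂ (there w∈m) = inj₂ (from w∈m)

      glued : ∀ j → Glued (into j) (out (σ j))
      glued j = glue (into j) (out (σ j)) (end∈X (into j)) (proj₂ (matched j))

      paths : DisjointPaths R⁺ A B k
      paths = (λ j → proj₁ (glued j)) , (λ j → proj₁ (proj₂ (glued j))) , disjoint
        where
          disjoint : PairwiseDisjoint (λ j → proj₁ (glued j))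
          disjoint a b a≢b wa wb with proj₂ (proj₂ (glued a)) wa | proj₂ (proj₂ (glued b)) wb
          ... | inj₁ fa        | inj₁ fb        = into-disjoint a b a≢b fa fb
          ... | inj₁ fa        | inj₂ (ob , ∉S) = ∉S (shared∈S (into a) (out (σ b)) fa ob)
          ... | inj₂ (oa , ∉S) | inj₁ fb        = ∉S (shared∈S (into b) (out (σ a)) fb oa)
          ... | inj₂ (oa , _)  | inj₂ (ob , _)  = out-disjoint (σ a) (σ b) (λ σ≡ → a≢b (σ-injective a b σ≡)) oa ob

    combine : ∀ {A B S k} → x ∉ₗ S → y ∉ₗ S → Separates R A B S → length S < k →
              DisjointPaths R A (_∈ₗ x ∷ S) k → DisjointPaths R (_∈ₗ y ∷ S) B k → DisjointPaths R⁺ A B k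
    combine {S = S} x∉S y∉S sep few (p , p-paths , p-disjoint) (q , q-paths , q-disjoint) =
      Glue.paths x∉S y∉S sep few (λ j → proj₁ (into j)) into-disjoint (λ j → proj₁ (out j)) out-disjoint
      where
        into : ∀ j → _
        into j = trimInto (x ∷ S) (p j) (p-paths j)
        out : ∀ j → _
        out j = trimOutOf (y ∷ S) (q j) (q-paths j)
        into-disjoint : PairwiseDisjoint (λ j → PathInto.vertices (proj₁ (into j)))
        into-disjoint a b a≢b wa wb = p-disjoint a b a≢b (proj₂ (into a) wa) (proj₂ (into b) wb)
        out-disjoint : PairwiseDisjoint (λ j → PathOutOf.vertices (proj₁ (out j)))
        out-disjoint a b a≢b wa wb = q-disjoint a b a≢b (proj₂ (out a) wa) (proj₂ (out b) wb)

  menger : ∀ L {A B} → (∀ v → Dec (A v)) → (∀ v → Dec (B v)) → ∀ k →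
           DisjointPaths (ArcsOf L) A B k ⊎ SmallSeparator (ArcsOf L) A B k
  menger [] A? B? k = menger-noArcs A? B? k
  menger ((x , y) ∷ L′) A? B? k with menger L′ A? B? k
  ... | inj₁ (p , p-paths , disjoint) =
    inj₁ (p , (λ j → AddArc.lift (proj₁ (p-paths j)) , proj₂ (p-paths j)) , disjoint)
  ... | inj₂ (S , few , sep) with x FinP.≟ y | x ∈? S | y ∈? S
  ...   | yes x≡y | _       | _       = inj₂ (S , few , AddArc.separates-loop x≡y sep)
  ...   | no _    | yes x∈S | _       = inj₂ (S , few , AddArc.separates-if-x∈ x∈S sep)
  ...   | no _    | no _    | yes y∈S = inj₂ (S , few , AddArc.separates-if-y∈ y∈S sep)
  ...   | no _    | no x∉S  | no y∉S
          with menger L′ A? (_∈? (x ∷ S)) k | menger L′ (_∈? (y ∷ S)) B? k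
  ...     | inj₂ (S′ , few′ , sep′) | _ =
            inj₂ (S′ , few′ , AddArc.separator-before (AddArc.separates-with-x sep) sep′)
  ...     | inj₁ _ | inj₂ (S′ , few′ , sep′) =
            inj₂ (S′ , few′ , AddArc.separator-after (AddArc.separates-with-y sep) sep′)
  ...     | inj₁ ps | inj₁ qs = inj₁ (AddArc.combine x∉S y∉S sep few ps qs)

elems : ∀ {n} → Subset n → List (Fin n)
elems {zero}  _            = []
elems {suc n} (true ∷ p)  = zero ∷ map suc (elems p)
elems {suc n} (false ∷ p) = map suc (elems p)

elems-length : ∀ {n} (p : Subset n) → length (elems p) ≡ ∣ p ∣
elems-length {zero}  []          = refl
elems-length {suc n} (true ∷ p)  = cong suc (trans (length-map suc (elems p)) (elems-length p))
elems-length {suc n} (false ∷ p) = trans (length-map suc (elems p)) (elems-length p)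

elems⇒∈ : ∀ {n} (p : Subset n) {v} → v ∈ₗ elems p → v ∈ p
elems⇒∈ {suc n} (true ∷ p)  (here refl) = here
elems⇒∈ {suc n} (true ∷ p)  (there v∈) with ∈-map⁻ suc v∈
... | w , w∈ , refl = there (elems⇒∈ p w∈)
elems⇒∈ {suc n} (false ∷ p) v∈ with ∈-map⁻ suc v∈
... | w , w∈ , refl = there (elems⇒∈ p w∈)

∈⇒elems : ∀ {n} (p : Subset n) {v} → v ∈ p → v ∈ₗ elems p
∈⇒elems {suc n} (true ∷ p)  here       = here refl
∈⇒elems {suc n} (true ∷ p)  (there v∈) = there (∈-map⁺ suc (∈⇒elems p v∈))
∈⇒elems {suc n} (false ∷ p) (there v∈) = ∈-map⁺ suc (∈⇒elems p v∈)

elems-unique : ∀ {n} (p : Subset n) → Unique (elems p)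
elems-unique {zero}  []          = []
elems-unique {suc n} (true ∷ p)  =
  All.tabulate (λ w∈ → zero∉ (∈-map⁻ suc w∈)) ∷ UniqueP.map⁺ FinP.suc-injective (elems-unique p)
  where
    zero∉ : ∀ {w} → (∃ λ z → z ∈ₗ elems p × w ≡ suc z) → zero ≢ w
    zero∉ (z , _ , refl) ()
elems-unique {suc n} (false ∷ p) = UniqueP.map⁺ FinP.suc-injective (elems-unique p)

toSubset⇒∈ : ∀ {n} (l : List (Fin n)) {v} → v ∈ toSubset l → v ∈ₗ l
toSubset⇒∈ []      v∈ = ⊥-elim (SubP.∉⊥ v∈)
toSubset⇒∈ (x ∷ l) v∈ with SubP.x∈p∪q⁻ ⁅ x ⁆ (toSubset l) v∈
... | inj₁ v∈x = here (SubP.x∈⁅y⁆⇒x≡y x v∈x)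
... | inj₂ v∈l = there (toSubset⇒∈ l v∈l)

∈⇒toSubset : ∀ {n} (l : List (Fin n)) {v} → v ∈ₗ l → v ∈ toSubset l
∈⇒toSubset (x ∷ l) (here refl) = SubP.x∈p∪q⁺ (inj₁ (SubP.x∈⁅x⁆ x))
∈⇒toSubset (x ∷ l) (there v∈)  = SubP.x∈p∪q⁺ (inj₂ (∈⇒toSubset l v∈))

card-toSubset : ∀ {n} (l : List (Fin n)) → ∣ toSubset l ∣ ≤ length l
card-toSubset l = subst (_≤ length l) (elems-length (toSubset l))
  (unique-length (elems (toSubset l)) l (elems-unique _) (λ v∈ → toSubset⇒∈ l (elems⇒∈ _ v∈)))

card-disjoint : ∀ {n} (p q r : Subset n) → Disjoint p q → p ⊆ r → q ⊆ r → ∣ p ∣ + ∣ q ∣ ≤ ∣ r ∣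
card-disjoint p q r p#q p⊆r q⊆r =
  subst₂ _≤_ (trans (length-++ (elems p)) (cong₂ _+_ (elems-length p) (elems-length q))) (elems-length r)
    (unique-length (elems p ++ elems q) (elems r)
      (unique-++ (elems p) (elems q) (elems-unique p) (elems-unique q)
        (λ v∈p v∈q → p#q _ (elems⇒∈ p v∈p) (elems⇒∈ q v∈q)))
      (λ v∈ → ∈⇒elems r (from (∈-++⁻ (elems p) v∈))))
  where
    from : ∀ {v} → v ∈ₗ elems p ⊎ v ∈ₗ elems q → v ∈ r
    from (inj₁ v∈p) = p⊆r (elems⇒∈ p v∈p)
    from (inj₂ v∈q) = q⊆r (elems⇒∈ q v∈q)

enumerate : ∀ {n} (p : Subset n) → Fin ∣ p ∣ → Fin n
enumerate p t = lookup (elems p) (cast (sym (elems-length p)) t)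

enumerate∈ : ∀ {n} (p : Subset n) t → enumerate p t ∈ p
enumerate∈ p t = elems⇒∈ p (lookup∈ (elems p) (cast (sym (elems-length p)) t))

enumerate-injective : ∀ {n} (p : Subset n) t t′ → enumerate p t ≡ enumerate p t′ → t ≡ t′
enumerate-injective p t t′ same = FinP.toℕ-injective (begin
  toℕ t                                 ≡⟨ FinP.toℕ-cast _ t ⟨
  toℕ (cast (sym (elems-length p)) t)   ≡⟨ cong toℕ (lookup-injective (elems p) (elems-unique p) _ _ same) ⟩
  toℕ (cast (sym (elems-length p)) t′)  ≡⟨ FinP.toℕ-cast _ t′ ⟩
  toℕ t′                                ∎)
  where open ≡-Reasoning

module _ {V : Set} where

  Pos : List V → ℕ → V → Set
  Pos []      _       _ = ⊥
  Pos (x ∷ l) zero    v = x ≡ v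
  Pos (x ∷ l) (suc r) v = Pos l r v

  pos-functional : ∀ l r {v v′} → Pos l r v → Pos l r v′ → v ≡ v′
  pos-functional (x ∷ l) zero    p q = trans (sym p) q
  pos-functional (x ∷ l) (suc r) p q = pos-functional l r p q

  pos⇒∈ : ∀ l r {v} → Pos l r v → v ∈ₗ l
  pos⇒∈ (x ∷ l) zero    p = here (sym p)
  pos⇒∈ (x ∷ l) (suc r) p = there (pos⇒∈ l r p)

  ∈⇒pos : ∀ l {v} → v ∈ₗ l → ∃ λ r → r < length l × Pos l r v
  ∈⇒pos (x ∷ l) (here refl) = zero , s≤s z≤n , refl
  ∈⇒pos (x ∷ l) (there v∈) with ∈⇒pos l v∈
  ... | r , r< , p = suc r , s≤s r< , p

  pos-unique : ∀ l → Unique l → ∀ r r′ {v} → Pos l r v → Pos l r′ v → r ≡ r′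
  pos-unique (x ∷ l) u        zero    zero     p    q    = refl
  pos-unique (x ∷ l) (px ∷ u) zero    (suc r′) refl q    = ⊥-elim (All.lookup px (pos⇒∈ l r′ q) refl)
  pos-unique (x ∷ l) (px ∷ u) (suc r) zero     p    refl = ⊥-elim (All.lookup px (pos⇒∈ l r p) refl)
  pos-unique (x ∷ l) (_ ∷ u)  (suc r) (suc r′) p    q    = cong suc (pos-unique l u r r′ p q)

  pos-++ˡ : ∀ l m r {v} → Pos l r v → Pos (l ++ m) r v
  pos-++ˡ (x ∷ l) m zero    p = p
  pos-++ˡ (x ∷ l) m (suc r) p = pos-++ˡ l m r p

  pos-++ʳ : ∀ l m r {v} → Pos m r v → Pos (l ++ m) (length l + r) v
  pos-++ʳ []      m r p = p
  pos-++ʳ (x ∷ l) m r p = pos-++ʳ l m r p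

  pos-middle : ∀ l v m → Pos (l ++ v ∷ m) (length l) v
  pos-middle []      v m = refl
  pos-middle (x ∷ l) v m = pos-middle l v m

module _ {n : ℕ} {E : Adj n} where

  reach-trans : ∀ {Z u v w} → Reach E Z u v → Reach E Z v w → Reach E Z u w
  reach-trans (here _)          q = q
  reach-trans (step u∈ arc rest) q = step u∈ arc (reach-trans rest q)

  reach-mono : ∀ {Z Z′ u v} → Z ⊆ Z′ → Reach E Z u v → Reach E Z′ u v
  reach-mono Z⊆ (here u∈)          = here (Z⊆ u∈)
  reach-mono Z⊆ (step u∈ arc rest) = step (Z⊆ u∈) arc (reach-mono Z⊆ rest)

  reach-source : ∀ {Z u v} → Reach E Z u v → u ∈ Z
  reach-source (here u∈)       = u∈
  reach-source (step u∈ _ _)   = u∈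

  reach⇒list : ∀ {Z u v} {A B : Fin n → Set} → Reach E Z u v → A u → B v →
               Σ (List (Fin n)) λ l → Linked (Arc E) l × HeadIn A l × LastIn B l × All (_∈ Z) l
  reach⇒list (here u∈) a b = _ ∷ [] , [-] , a , b , u∈ ∷ []
  reach⇒list (step {w = w} u∈ arc rest) a b with reach⇒list {A = _≡ w} rest refl b
  ... | []    , _  , ()   , _
  ... | z ∷ l , lk , refl , lb , in-Z = _ ∷ z ∷ l , arc ∷ lk , a , lb , u∈ ∷ in-Z

  walkAlong : ∀ {Z} l → Linked (Arc E) l → ∀ p q {u v} → Pos l p u → Pos l q v → p ≤ q →
              (∀ r {z} → p ≤ r → r ≤ q → Pos l r z → z ∈ Z) → Reach E Z u v
  walkAlong (x ∷ l)       lk        zero    zero    refl refl z≤n in-Z = here (in-Z zero z≤n z≤n refl)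
  walkAlong (x ∷ [])      lk        zero    (suc q) refl ()   z≤n in-Z
  walkAlong (x ∷ (y ∷ l)) (arc ∷ lk) zero    (suc q) refl pv   z≤n in-Z =
    step (in-Z zero z≤n z≤n refl) arc
      (walkAlong (y ∷ l) lk zero q refl pv z≤n (λ r _ r≤q at → in-Z (suc r) z≤n (s≤s r≤q) at))
  walkAlong (x ∷ l)       lk        (suc p) (suc q) pu   pv   (s≤s p≤q) in-Z =
    walkAlong l (Linked.tail lk) p q pu pv p≤q (λ r p≤r r≤q at → in-Z (suc r) (s≤s p≤r) (s≤s r≤q) at)

-- the vertices outside a list S, i.e. the graph D − S
Free : ∀ {n} → List (Fin n) → Subset n
Free S = ∁ (toSubset S)

free⇒∉ : ∀ {n} {S : List (Fin n)} {v} → v ∈ Free S → v ∉ₗ S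
free⇒∉ {S = S} v∈ v∈S = SubP.x∈∁p⇒x∉p v∈ (∈⇒toSubset S v∈S)

∉⇒free : ∀ {n} {S : List (Fin n)} {v} → v ∉ₗ S → v ∈ Free S
∉⇒free {S = S} v∉ = SubP.x∉p⇒x∈∁p (λ v∈ → v∉ (toSubset⇒∈ S v∈))

-- A hub skeleton of a path PP with spokes a₀ … a_{i-1}: hub positions
-- hub 0 < spoke 0 < hub 1 < spoke 1 < … < spoke (i-1) < hub i along PP,
-- the j-th spoke carrying aⱼ and every hub vertex satisfying Hub.
record Skeleton {V : Set} (Hub : V → Set) (PP : List V) (i : ℕ) (a : Fin i → V) : Set where
  field
    hub       : ℕ → ℕ
    hubV      : ℕ → V
    spoke     : Fin i → ℕ
    hub-at    : ∀ t → t ≤ i → Pos PP (hub t) (hubV t)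
    hub-ok    : ∀ t → t ≤ i → Hub (hubV t)
    spoke-at  : ∀ j → Pos PP (spoke j) (a j)
    hub<spoke : ∀ j → hub (toℕ j) < spoke j
    spoke<hub : ∀ j → spoke j < hub (suc (toℕ j))

module _ {V : Set} {Hub : V → Set} where

  skeleton-end : ∀ {R : List V} {a : Fin 0 → V} {c} → c ∈ₗ R → Hub c → Skeleton Hub R 0 a
  skeleton-end {R} c∈ hc with ∈⇒pos R c∈
  ... | p , _ , at = record
    { hub = λ _ → p ; hubV = λ _ → _ ; spoke = λ () ; hub-at = λ _ _ → at ; hub-ok = λ _ _ → hc
    ; spoke-at = λ () ; hub<spoke = λ () ; spoke<hub = λ () }

  skeleton-cons : ∀ {i} {PP : List V} {a : Fin (suc i) → V} (Q₀ : List V) {c} → c ∈ₗ Q₀ → Hub c →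
                  Skeleton Hub PP i (λ j → a (suc j)) → Skeleton Hub ((Q₀ ++ [ a zero ]) ++ PP) (suc i) a
  skeleton-cons {i} {PP} {a} Q₀ {c} c∈ hc sk with ∈⇒pos Q₀ c∈
  ... | p , p< , c-at = record
    { hub = hub⁺ ; hubV = hubV⁺ ; spoke = spoke⁺ ; hub-at = hub-at⁺ ; hub-ok = hub-ok⁺
    ; spoke-at = spoke-at⁺ ; hub<spoke = hub<spoke⁺ ; spoke<hub = spoke<hub⁺ }
    where
      open Skeleton sk
      h = Q₀ ++ [ a zero ]
      Q₀<h : ∀ r → length Q₀ < length h + r
      Q₀<h r = ℕP.<-≤-trans (subst (length Q₀ <_) (sym (length-++ Q₀)) (ℕP.m<m+n (length Q₀) (s≤s z≤n)))
                            (ℕP.m≤m+n (length h) r)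
      hub⁺ : ℕ → ℕ
      hub⁺ zero    = p
      hub⁺ (suc t) = length h + hub t
      hubV⁺ : ℕ → V
      hubV⁺ zero    = c
      hubV⁺ (suc t) = hubV t
      spoke⁺ : Fin (suc i) → ℕ
      spoke⁺ zero    = length Q₀
      spoke⁺ (suc j) = length h + spoke j
      hub-at⁺ : ∀ t → t ≤ suc i → Pos (h ++ PP) (hub⁺ t) (hubV⁺ t)
      hub-at⁺ zero    _         = pos-++ˡ h PP p (pos-++ˡ Q₀ [ a zero ] p c-at)
      hub-at⁺ (suc t) (s≤s t≤i) = pos-++ʳ h PP (hub t) (hub-at t t≤i)
      hub-ok⁺ : ∀ t → t ≤ suc i → Hub (hubV⁺ t)
      hub-ok⁺ zero    _         = hc
      hub-ok⁺ (suc t) (s≤s t≤i) = hub-ok t t≤i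
      spoke-at⁺ : ∀ j → Pos (h ++ PP) (spoke⁺ j) (a j)
      spoke-at⁺ zero    = pos-++ˡ h PP (length Q₀) (pos-middle Q₀ (a zero) [])
      spoke-at⁺ (suc j) = pos-++ʳ h PP (spoke j) (spoke-at j)
      hub<spoke⁺ : ∀ j → hub⁺ (toℕ j) < spoke⁺ j
      hub<spoke⁺ zero    = p<
      hub<spoke⁺ (suc j) = ℕP.+-monoʳ-< (length h) (hub<spoke j)
      spoke<hub⁺ : ∀ j → spoke⁺ j < hub⁺ (suc (toℕ j))
      spoke<hub⁺ zero    = Q₀<h (hub zero)
      spoke<hub⁺ (suc j) = ℕP.+-monoʳ-< (length h) (spoke<hub j)

blocks-suc : ∀ {m : ℕ} i (Q : Fin (suc i) → List (Fin m)) (a : Fin (suc i) → Fin m) →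
  blocks (suc i) Q a ≡ (Q zero ++ [ a zero ]) ++ blocks i (λ j → Q (suc j)) (λ j → a (suc j))
blocks-suc i Q a = cong ((Q zero ++ [ a zero ]) ++_)
  (cong concat (trans (map-tabulate suc block) (sym (map-tabulate id (λ j → block (suc j))))))
  where block = λ j → Q j ++ [ a j ]

layout : ∀ {n} {Hub : Fin n → Set} i (Q : Fin i → List (Fin n)) (a : Fin i → Fin n) R →
         (∀ j → ∃ λ c → c ∈ₗ Q j × Hub c) → (∃ λ c → c ∈ₗ R × Hub c) →
         Skeleton Hub (blocks i Q a ++ R) i a
layout zero    Q a R hubsQ (c , c∈ , hc) = skeleton-end c∈ hc
layout {Hub = Hub} (suc i) Q a R hubsQ hubR =
  subst (λ L → Skeleton Hub L (suc i) a) (sym split)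
    (skeleton-cons (Q zero) (proj₁ (proj₂ (hubsQ zero))) (proj₂ (proj₂ (hubsQ zero)))
      (layout i (λ j → Q (suc j)) (λ j → a (suc j)) R (λ j → hubsQ (suc j)) hubR))
  where
    split : blocks (suc i) Q a ++ R ≡ (Q zero ++ [ a zero ]) ++ (blocks i (λ j → Q (suc j)) (λ j → a (suc j)) ++ R)
    split = trans (cong (_++ R) (blocks-suc i Q a)) (++-assoc (Q zero ++ [ a zero ]) _ R)

-- Reasoning classically towards ⊥: finitely many ¬¬-facts hold jointly.
¬¬-∀-Fin : ∀ {k} {P : Fin k → Set} → (∀ j → ¬ ¬ P j) → ¬ ¬ (∀ j → P j)
¬¬-∀-Fin {zero}      each refute = refute (λ ())
¬¬-∀-Fin {suc k} {P} each refute =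
  each zero λ p₀ → ¬¬-∀-Fin {P = λ j → P (suc j)} (λ j → each (suc j))
    λ rest → refute λ { zero → p₀ ; (suc j) → rest j }

-- The j-th segment runs from hub j
-- to hub (j+1) and contains the spoke aⱼ.  Segments share only hubs, which
-- avoid S, so S meets at most |S| segments; two spokes with S-free
-- segments are connected in D − S.
module Segments {n} {E : Adj n} {Hub : Fin n → Set} {PP : List (Fin n)} {i} {a : Fin i → Fin n}
  (sk : Skeleton Hub PP i a) (PP-unique : Unique PP) (PP-path : Linked (Arc E) PP)
  (S : List (Fin n)) (hubs-connected : ∀ {z z′} → Hub z → Hub z′ → Reach E (Free S) z z′) where

  open Skeleton sk

  hub-free : ∀ t → t ≤ i → hubV t ∈ Free S
  hub-free t t≤i = reach-source (hubs-connected (hub-ok t t≤i) (hub-ok t t≤i))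

  hub-step : ∀ t → t < i → hub t < hub (suc t)
  hub-step t t<i = subst (λ u → hub u < hub (suc u)) (FinP.toℕ-fromℕ< t<i)
                     (ℕP.<-trans (hub<spoke (fromℕ< t<i)) (spoke<hub (fromℕ< t<i)))

  hub-mono : ∀ t t′ → t ≤ t′ → t′ ≤ i → hub t ≤ hub t′
  hub-mono t zero    z≤n  _     = ℕP.≤-refl
  hub-mono t (suc t′) t≤ t′<i with ℕP.m≤n⇒m<n∨m≡n t≤
  ... | inj₂ refl       = ℕP.≤-refl
  ... | inj₁ (s≤s t≤t′) = ℕP.≤-trans (hub-mono t t′ t≤t′ (ℕP.<⇒≤ t′<i)) (ℕP.<⇒≤ (hub-step t′ t′<i))

  Clean : Fin i → Set
  Clean j = ∀ r {z} → hub (toℕ j) ≤ r → r ≤ hub (suc (toℕ j)) → Pos PP r z → z ∈ Free S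

  record Dirt (j : Fin i) : Set where
    field
      vertex   : Fin n
      vertex∈S : vertex ∈ₗ S
      position : ℕ
      from     : hub (toℕ j) ≤ position
      to       : position ≤ hub (suc (toℕ j))
      at       : Pos PP position vertex

  clean-unless-dirty : ∀ j → ¬ Dirt j → Clean j
  clean-unless-dirty j no-dirt r from to at = ∉⇒free λ z∈S → no-dirt (record
    { vertex = _ ; vertex∈S = z∈S ; position = r ; from = from ; to = to ; at = at })

  -- a vertex on two segments j < j′ is the hub j+1, which avoids S
  dirt-separated : ∀ {j j′} → toℕ j < toℕ j′ → (d : Dirt j) (d′ : Dirt j′) →
                   Dirt.vertex d ≡ Dirt.vertex d′ → ⊥
  dirt-separated {j} {j′} j<j′ d d′ same =
    free⇒∉ (hub-free (suc (toℕ j)) (FinP.toℕ<n j))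
      (subst (_∈ₗ S) (pos-functional PP _ (subst (λ r → Pos PP r _) at-hub (Dirt.at d))
                                           (hub-at (suc (toℕ j)) (FinP.toℕ<n j)))
             (Dirt.vertex∈S d))
    where
      same-position : Dirt.position d ≡ Dirt.position d′
      same-position = pos-unique PP PP-unique _ _ (Dirt.at d) (subst (Pos PP _) (sym same) (Dirt.at d′))
      at-hub : Dirt.position d ≡ hub (suc (toℕ j))
      at-hub = ℕP.≤-antisym (Dirt.to d)
        (ℕP.≤-trans (hub-mono (suc (toℕ j)) (toℕ j′) j<j′ (ℕP.<⇒≤ (FinP.toℕ<n j′)))
                    (ℕP.≤-trans (Dirt.from d′) (ℕP.≤-reflexive (sym same-position))))

  dirt-injective : ∀ {j j′} (d : Dirt j) (d′ : Dirt j′) → Dirt.vertex d ≡ Dirt.vertex d′ → j ≡ j′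
  dirt-injective {j} {j′} d d′ same with ℕP.<-cmp (toℕ j) (toℕ j′)
  ... | tri< j<j′ _ _ = ⊥-elim (dirt-separated j<j′ d d′ same)
  ... | tri≈ _ j≡j′ _ = FinP.toℕ-injective j≡j′
  ... | tri> _ _ j′<j = ⊥-elim (dirt-separated j′<j d′ d (sym same))

  clean-spoke : ∀ Z → Z ⊆ toSubset (map a (allFin i)) → length S < ∣ Z ∣ →
                ¬ ¬ (∃ λ j → a j ∈ Z × Clean j)
  clean-spoke Z Z⊆A few no-clean =
    ¬¬-∀-Fin dirty λ dirt → collision dirt (pigeonhole S few (vertexOf dirt) (λ t → Dirt.vertex∈S (dirt t)))
    where
      index : ∀ t → ∃ λ j → a j ≡ enumerate Z t
      index t with ∈-map⁻ a {xs = allFin i} (toSubset⇒∈ (map a (allFin i)) (Z⊆A (enumerate∈ Z t)))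
      ... | j , _ , eq = j , sym eq
      dirty : ∀ t → ¬ ¬ Dirt (proj₁ (index t))
      dirty t no-dirt = no-clean (proj₁ (index t) , subst (_∈ Z) (sym (proj₂ (index t))) (enumerate∈ Z t) ,
                                  clean-unless-dirty _ no-dirt)
      vertexOf : (∀ t → Dirt (proj₁ (index t))) → Fin ∣ Z ∣ → Fin n
      vertexOf dirt t = Dirt.vertex (dirt t)
      collision : ∀ dirt → (∃₂ λ t t′ → t ≢ t′ × vertexOf dirt t ≡ vertexOf dirt t′) → ⊥
      collision dirt (t , t′ , t≢t′ , same) = t≢t′ (enumerate-injective Z t t′ (begin
        enumerate Z t          ≡⟨ proj₂ (index t) ⟨
        a (proj₁ (index t))    ≡⟨ cong a (dirt-injective (dirt t) (dirt t′) same) ⟩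
        a (proj₁ (index t′))   ≡⟨ proj₂ (index t′) ⟩
        enumerate Z t′         ∎))
        where open ≡-Reasoning

  clean-walk : ∀ j j′ → Clean j → Clean j′ → Reach E (Free S) (a j) (a j′)
  clean-walk j j′ clean clean′ = reach-trans forth (reach-trans across back)
    where
      forth : Reach E (Free S) (a j) (hubV (suc (toℕ j)))
      forth = walkAlong PP PP-path (spoke j) (hub (suc (toℕ j))) (spoke-at j) (hub-at _ (FinP.toℕ<n j))
                (ℕP.<⇒≤ (spoke<hub j)) (λ r from to → clean r (ℕP.≤-trans (ℕP.<⇒≤ (hub<spoke j)) from) to)
      across : Reach E (Free S) (hubV (suc (toℕ j))) (hubV (toℕ j′))
      across = hubs-connected (hub-ok _ (FinP.toℕ<n j)) (hub-ok _ (ℕP.<⇒≤ (FinP.toℕ<n j′)))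
      back : Reach E (Free S) (hubV (toℕ j′)) (a j′)
      back = walkAlong PP PP-path (hub (toℕ j′)) (spoke j′) (hub-at _ (ℕP.<⇒≤ (FinP.toℕ<n j′))) (spoke-at j′)
               (ℕP.<⇒≤ (hub<spoke j′)) (λ r from to → clean′ r from (ℕP.≤-trans to (ℕP.<⇒≤ (spoke<hub j′))))

g-expand : ∀ k → g k ≡ k * (⌊ k /2⌋ + 1) + ⌊ k /2⌋
g-expand k = cong (_∸ 1)
  (solve 2 (λ k h → (k :+ con 1) :* (h :+ con 1) := con 1 :+ (k :* (h :+ con 1) :+ h)) refl k ⌊ k /2⌋)
  where open +-*-Solver

g-positive : ∀ k → 1 ≤ k → 1 ≤ g k
g-positive k 1≤k = begin
  1                             ≤⟨ 1≤k ⟩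
  k                             ≡⟨ ℕP.*-identityʳ k ⟨
  k * 1                         ≤⟨ ℕP.*-monoʳ-≤ k (ℕP.m≤n+m 1 ⌊ k /2⌋) ⟩
  k * (⌊ k /2⌋ + 1)             ≤⟨ ℕP.m≤m+n _ ⌊ k /2⌋ ⟩
  k * (⌊ k /2⌋ + 1) + ⌊ k /2⌋   ≡⟨ g-expand k ⟨
  g k                           ∎
  where open ℕP.≤-Reasoning

rest-order-bound : ∀ k i → i ≤ k → ⌊ k /2⌋ ≤ g k ∸ i * (⌊ k /2⌋ + 1)
rest-order-bound k i i≤k = begin
  ⌊ k /2⌋                                              ≡⟨ ℕP.m+n∸m≡n (k * (⌊ k /2⌋ + 1)) ⌊ k /2⌋ ⟨
  k * (⌊ k /2⌋ + 1) + ⌊ k /2⌋ ∸ k * (⌊ k /2⌋ + 1)       ≤⟨ ℕP.∸-monoʳ-≤ _ (ℕP.*-monoˡ-≤ (⌊ k /2⌋ + 1) i≤k) ⟩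
  k * (⌊ k /2⌋ + 1) + ⌊ k /2⌋ ∸ i * (⌊ k /2⌋ + 1)       ≡⟨ cong (_∸ i * (⌊ k /2⌋ + 1)) (g-expand k) ⟨
  g k ∸ i * (⌊ k /2⌋ + 1)                              ∎
  where open ℕP.≤-Reasoning

twice-minus-one< : ∀ G → 1 ≤ G → 2 * G ∸ 1 < G + G
twice-minus-one< (suc G) _ = subst (λ t → G + t < suc G + suc G) (sym (ℕP.+-identityʳ (suc G))) (ℕP.n<1+n _)

half-bound : ∀ m k → m + m ≤ k → m ≤ ⌊ k /2⌋
half-bound m k m+m≤k = subst (_≤ ⌊ k /2⌋) (sym (ℕP.n≡⌊n+n/2⌋ m)) (ℕP.⌊n/2⌋-mono m+m≤k)

-- Brambles.  A set X smaller than the order of ℱ misses some member of ℱ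
-- (classically: otherwise X would be a hitting set).
misses-member : ∀ {n} (ℱ : Family n) {m} (X : Subset n) → OrderAtLeast ℱ m → ∣ X ∣ < m →
                ¬ ¬ (Σ (Subset n) (Avoiding ℱ X))
misses-member ℱ X order small none = ℕP.<⇒≱ small (order X hits)
  where
    hits : Hits ℱ X
    hits B B∈ℱ with FinP.any? (λ v → (v SubP.∈? B) ×-dec (v SubP.∈? X))
    ... | yes shared = shared
    ... | no disjoint = ⊥-elim (none (B , B∈ℱ , λ v v∈B v∈X → disjoint (v , v∈B , v∈X)))

tBramble-meet : ∀ {n} {E : Adj n} {T : Subset n} {G B B′} → ∣ T ∣ < G + G →
                TBramble E T G B → TBramble E T G B′ → ∃ λ v → v ∈ B × v ∈ B′
tBramble-meet {T = T} {G} {B} {B′} T-small (_ , G≤B) (_ , G≤B′)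
  with FinP.any? (λ v → (v SubP.∈? B) ×-dec (v SubP.∈? B′))
... | yes shared = shared
... | no disjoint = ⊥-elim (ℕP.<⇒≱ T-small (ℕP.≤-trans (ℕP.+-mono-≤ G≤B G≤B′)
        (card-disjoint (B ∩ T) (B′ ∩ T) T
          (λ v v∈B v∈B′ → disjoint (v , proj₁ (SubP.x∈p∩q⁻ B T v∈B) , proj₁ (SubP.x∈p∩q⁻ B′ T v∈B′)))
          (λ v∈ → proj₂ (SubP.x∈p∩q⁻ B T v∈)) (λ v∈ → proj₂ (SubP.x∈p∩q⁻ B′ T v∈)))))

tBramble-reach : ∀ {n} {E : Adj n} {T X : Subset n} {G B B′ z z′} → ∣ T ∣ < G + G →
                 Avoiding (TBramble E T G) X B → Avoiding (TBramble E T G) X B′ →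
                 z ∈ B → z′ ∈ B′ → Reach E (∁ X) z z′
tBramble-reach T-small (B∈ , B∉X) (B′∈ , B′∉X) z∈B z′∈B′ with tBramble-meet T-small B∈ B′∈
... | w , w∈B , w∈B′ =
  reach-trans (reach-mono (λ v∈ → SubP.x∉p⇒x∈∁p (B∉X _ v∈)) (proj₂ (proj₁ B∈) _ _ z∈B w∈B))
              (reach-mono (λ v∈ → SubP.x∉p⇒x∈∁p (B′∉X _ v∈)) (proj₂ (proj₁ B′∈) _ _ w∈B′ z′∈B′))

module _ {n : ℕ} (E : Adj n) where
  open Menger

  arcList : List (Fin n × Fin n)
  arcList = filter (λ (u , v) → E u v BoolP.≟ true) (cartesianProduct (allFin n) (allFin n))

  listed⇒arc : ∀ {u v} → ArcsOf arcList u v → Arc E u v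
  listed⇒arc uv∈ = proj₂ (∈-filter⁻ (λ (u , v) → E u v BoolP.≟ true)
                            {xs = cartesianProduct (allFin n) (allFin n)} uv∈)

  arc⇒listed : ∀ {u v} → Arc E u v → ArcsOf arcList u v
  arc⇒listed {u} {v} arc = ∈-filter⁺ (λ (u , v) → E u v BoolP.≟ true)
                             (∈-cartesianProduct⁺ (∈-allFin u) (∈-allFin v)) arc

  path⇒dpath : ∀ {X Y : Subset n} l → PathFromTo (ArcsOf arcList) (_∈ X) (_∈ Y) l → IsDPathFromTo E X Y l
  path⇒dpath (x ∷ l) (lk , u , x∈X , ends) =
    ((λ ()) , u , Linked.map listed⇒arc lk) , (x , refl , x∈X) , lastIn⇒last (x ∷ l) ends

  separator-meets-walk : ∀ {A B : Fin n → Set} {S u v} → Separates (ArcsOf arcList) A B S →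
                         Reach E (Free S) u v → A u → B v → ⊥
  separator-meets-walk sep walk au bv with reach⇒list walk au bv
  ... | l , lk , starts , ends , free with sep l (Linked.map arc⇒listed lk) starts ends
  ...   | w , w∈l , w∈S = free⇒∉ (All.lookup free w∈l) w∈S

  wellLinked-by-menger : ∀ A → (∀ X Y → X ⊆ A → Y ⊆ A → Disjoint X Y → ∣ X ∣ ≡ ∣ Y ∣ →
                           ∀ S → length S < ∣ X ∣ → Separates (ArcsOf arcList) (_∈ X) (_∈ Y) S → ⊥) →
                         WellLinked E A
  wellLinked-by-menger A no-separator X Y X⊆A Y⊆A X#Y |X|≡|Y|
    with menger arcList (λ v → v SubP.∈? X) (λ v → v SubP.∈? Y) ∣ X ∣
  ... | inj₁ (p , p-paths , p-disjoint) =
    p , (λ j → path⇒dpath (p j) (p-paths j)) ,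
    (λ j j′ j≢j′ v v∈ v∈′ → p-disjoint j j′ j≢j′ (toSubset⇒∈ (p j) v∈) (toSubset⇒∈ (p j′) v∈′))
  ... | inj₂ (S , few , sep) = ⊥-elim (no-separator X Y X⊆A Y⊆A X#Y |X|≡|Y| S few sep)

module SplitArgument {n} {E : Adj n} {T : Subset n} {k : ℕ} {P : List (Fin n)} {i : ℕ}
  (k≥1 : 1 ≤ k) (T-size : ∣ T ∣ ≡ 2 * g k ∸ 1) (P-path : IsDPath E P)
  (P-hits : Hits (TBramble E T (g k)) (toSubset P)) (i≤k : i ≤ k) (s : Split E T k P i) where

  open Split s
  open Menger using (Separates; ArcsOf)

  T-small : ∣ T ∣ < g k + g k
  T-small = subst (_< g k + g k) (sym T-size) (twice-minus-one< (g k) (g-positive k k≥1))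

  half-of-split : ∀ X Y → X ⊆ splitVertices s → Y ⊆ splitVertices s → Disjoint X Y → ∣ X ∣ ≡ ∣ Y ∣ →
                  ∣ X ∣ ≤ ⌊ k /2⌋
  half-of-split X Y X⊆A Y⊆A X#Y |X|≡|Y| = half-bound ∣ X ∣ k (begin
    ∣ X ∣ + ∣ X ∣                ≡⟨ cong (∣ X ∣ +_) |X|≡|Y| ⟩
    ∣ X ∣ + ∣ Y ∣                ≤⟨ card-disjoint X Y _ X#Y X⊆A Y⊆A ⟩
    ∣ splitVertices s ∣          ≤⟨ card-toSubset (map a (allFin i)) ⟩
    length (map a (allFin i))    ≡⟨ trans (length-map a (allFin i)) (length-tabulate id) ⟩
    i                            ≤⟨ i≤k ⟩
    k                            ∎)
    where open ℕP.≤-Reasoning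

  Hub : List (Fin n) → Fin n → Set
  Hub S z = Σ (Subset n) λ B → Avoiding (TBramble E T (g k)) (toSubset S) B × z ∈ B

  hubs-connected : ∀ S {z z′} → Hub S z → Hub S z′ → Reach E (Free S) z z′
  hubs-connected S (B , B-avoids , z∈B) (B′ , B′-avoids , z′∈B′) = tBramble-reach T-small B-avoids B′-avoids z∈B z′∈B′

  hub-on-Q : ∀ S j → Σ (Subset n) (Avoiding (ℬ j) (toSubset S)) → ∃ λ c → c ∈ₗ Q j × Hub S c
  hub-on-Q S j (B , B∈ , B∉S) with Q-hits j B B∈
  ... | c , c∈B , c∈Q = c , toSubset⇒∈ (Q j) c∈Q , B , (ℬ-sub j B B∈ , B∉S) , c∈B

  -- a member of ℬ̄_T(Xᵢ) avoiding S is hit by P outside Xᵢ, i.e. on Pᵢ, in a hub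
  hub-on-Pᵢ : ∀ S → Σ (Subset n) (Avoiding (Avoiding (TBramble E T (g k)) (toSubset (blocks i Q a))) (toSubset S)) →
              ∃ λ c → c ∈ₗ Pᵢ × Hub S c
  hub-on-Pᵢ S (B , (B∈ , B∉Xᵢ) , B∉S) with P-hits B B∈
  ... | c , c∈B , c∈P with ∈-++⁻ (blocks i Q a) (subst (c ∈ₗ_) decomp (toSubset⇒∈ P c∈P))
  ...   | inj₁ c∈Xᵢ = ⊥-elim (B∉Xᵢ c c∈B (∈⇒toSubset _ c∈Xᵢ))
  ...   | inj₂ c∈Pᵢ = c , c∈Pᵢ , B , (B∈ , B∉S) , c∈B

  no-small-separator : ∀ X Y → X ⊆ splitVertices s → Y ⊆ splitVertices s → Disjoint X Y → ∣ X ∣ ≡ ∣ Y ∣ →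
                       ∀ S → length S < ∣ X ∣ → Separates (ArcsOf (arcList E)) (_∈ X) (_∈ Y) S → ⊥
  no-small-separator X Y X⊆A Y⊆A X#Y |X|≡|Y| S few sep =
    ¬¬-∀-Fin (λ j → misses-member (ℬ j) (toSubset S) (ℬ-order j) S-small) λ Bs →
    misses-member _ (toSubset S) rest-order (ℕP.<-≤-trans S-small (rest-order-bound k i i≤k)) λ Bᵣ →
    let open Segments (layout i Q a Pᵢ (λ j → hub-on-Q S j (Bs j)) (hub-on-Pᵢ S Bᵣ))
                      PP-unique PP-path S (hubs-connected S) in
    clean-spoke X X⊆A few λ (jx , ax∈X , x-clean) →
    clean-spoke Y Y⊆A (subst (length S <_) |X|≡|Y| few) λ (jy , ay∈Y , y-clean) →
    separator-meets-walk E sep (clean-walk jx jy x-clean y-clean) ax∈X ay∈Y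
    where
      S-small : ∣ toSubset S ∣ < ⌊ k /2⌋
      S-small = ℕP.≤-<-trans (card-toSubset S) (ℕP.<-≤-trans few (half-of-split X Y X⊆A Y⊆A X#Y |X|≡|Y|))
      PP-unique : Unique (blocks i Q a ++ Pᵢ)
      PP-unique = subst Unique decomp (proj₁ (proj₂ P-path))
      PP-path : Linked (Arc E) (blocks i Q a ++ Pᵢ)
      PP-path = subst (Linked (Arc E)) decomp (proj₂ (proj₂ P-path))

-- Theorem 13.
mainTheorem13 : (k : ℕ) → 1 ≤ k →
    (n : ℕ) (E : Adj n) (T : Subset n) →
    IsLinked E T (g k ∸ 1) (g k ∸ 1) →
    ∣ T ∣ ≡ 2 * g k ∸ 1 →
    (P : List (Fin n)) → IsDPath E P →
    Hits (TBramble E T (g k)) (toSubset P) →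
    (i : ℕ) → 1 ≤ i → i ≤ k →
    (s : Split E T k P i) →
    WellLinked E (splitVertices s)
mainTheorem13 k k≥1 n E T _ T-size P P-path P-hits i _ i≤k s =
  wellLinked-by-menger E (splitVertices s)
    (SplitArgument.no-small-separator k≥1 T-size P-path P-hits i≤k s)
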